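{- With $v_1,v_2,v_3$ as defined in the context, the sets $\{v_1(n)\mid n\in\mathbb{N}\}$, $\{v_2(n)\mid n\in\mathbb{N}\}$, $\{v_3(n)\mid n\in\mathbb{N}\}$ are pairwise disjoint and their union is $\mathbb{N}$ (the positive integers).
   Context: $\mathbb{N}_0$ denotes the non-negative integers and $\mathbb{N}=\mathbb{N}_0\setminus\{0\}$. For $F\subset\mathbb{N}_0$ let $\mathrm{Mex}(F)=\min(\mathbb{N}_0\setminus F)$, and $a+D=\{a+d:d\in D\}$. Define recursively: $G_0=\{(0,0,0)\}$; for $n\ge 0$, let $F_n$ be the set of all coordinates of all triples in $G_n$, $D_n=\bigcup_{x\in G_n}\{x_2-x_1,x_3-x_2,x_3-x_1\}$, and $v_1(n+1)=\mathrm{Mex}(F_n)$, $v_2(n+1)=\mathrm{Mex}\big((v_1(n+1)+D_n)\cup\{1,\dots,v_1(n+1)\}\cup F_n\big)$, $v_3(n+1)=\mathrm{Mex}\big((v_2(n+1)+D_n)\cup\{1,\dots,v_2(n+1)\}\cup F_n\big)$, $G_{n+1}=G_n\cup\{(v_1(n+1),v_2(n+1),v_3(n+1))\}$. -}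

module Defs where

open import Data.Nat using (ℕ; zero; suc; _+_; _∸_; _≡ᵇ_)
open import Data.Bool using (Bool; if_then_else_)
open import Data.List using (List; []; _∷_; _++_; length; map; concatMap; upTo)
open import Data.Bool.ListAction using (any)
open import Data.Product using (_×_; _,_; proj₁; proj₂)

Triple : Set
Triple = ℕ × ℕ × ℕ

elem : ℕ → List ℕ → Bool
elem k l = any (k ≡ᵇ_) l

mexSearch : ℕ → ℕ → List ℕ → ℕ
mexSearch zero    k l = k
mexSearch (suc f) k l = if elem k l then mexSearch f (suc k) l else k

-- Mex(F) = min (ℕ₀ \ F) for a finite F given as a list;
-- among 0..length l some number is missing, so this fuel suffices.
Mex : List ℕ → ℕ
Mex l = mexSearch (suc (length l)) 0 l

coords : List Triple → List ℕ
coords = concatMap (λ { (a , b , c) → a ∷ b ∷ c ∷ [] })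

-- D_n : all differences x₂-x₁, x₃-x₂, x₃-x₁ (triples are increasing, so ∸ is exact)
diffs : List Triple → List ℕ
diffs = concatMap (λ { (a , b , c) → (b ∸ a) ∷ (c ∸ b) ∷ (c ∸ a) ∷ [] })

oneTo : ℕ → List ℕ
oneTo m = map suc (upTo m)

excluded : ℕ → List Triple → List ℕ
excluded a G = map (a +_) (diffs G) ++ oneTo a ++ coords G

step : List Triple → Triple
step G =
  let a = Mex (coords G)
      b = Mex (excluded a G)
      c = Mex (excluded b G)
  in a , b , c

G : ℕ → List Triple
G zero    = (0 , 0 , 0) ∷ []
G (suc n) = G n ++ (step (G n) ∷ [])

-- v₁, v₂, v₃ on ℕ = {1,2,…}; the value at 0 is a meaningless placeholder (0)
v₁ v₂ v₃ : ℕ → ℕ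
v₁ zero    = 0
v₁ (suc n) = proj₁ (step (G n))
v₂ zero    = 0
v₂ (suc n) = proj₁ (proj₂ (step (G n)))
v₃ zero    = 0
v₃ (suc n) = proj₂ (proj₂ (step (G n)))

{-# OPTIONS --safe #-}
-- Every coordinate of a new triple avoids F_n, since F_n is contained in each set whose Mex is
-- taken, and within a triple v₁ < v₂ < v₃, since {1, …, v₁} resp. {1, …, v₂} is excluded as well.
-- Hence coordinates of different triples (and of one triple) are distinct. Conversely v₁(n+1) is
-- the least number missing from F_n, so F_n ⊇ {0, …, n} and every k ≥ 1 is a coordinate of some
-- triple.
module Submission where

open import Defs
open import Data.Nat using (ℕ; zero; suc; _≤_; _<_; _+_; _≡ᵇ_; z≤n)
open import Data.Nat.Properties
open import Data.Product using (_×_; ∃-syntax; _,_)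
open import Data.Sum using (_⊎_; inj₁; inj₂)
import Data.Sum as Sum
open import Data.Bool using (true; false)
open import Data.Fin using (toℕ)
open import Data.Fin.Properties using (pigeonhole; toℕ<n)
open import Data.List using (List; []; _∷_; _++_; length; map; upTo)
open import Data.List.Properties using (concatMap-++)
open import Data.List.Relation.Unary.Any using (here; there; index)
import Data.List.Relation.Unary.Any as Any
open import Data.List.Relation.Unary.Any.Properties using (any⁺; any⁻)
open import Data.List.Membership.Propositional using (_∈_; _∉_)
open import Data.List.Membership.Propositional.Properties using (∈-map⁺; ∈-++⁻; ∈-upTo⁺; ∈-upTo⁻)
open import Data.List.Membership.Setoid.Properties using (index-injective)
open import Data.List.Relation.Binary.Subset.Propositional using (_⊆_; _⊈_)
open import Data.List.Relation.Binary.Subset.Propositional.Properties using (⊆-refl; ⊆-trans; xs⊆xs++ys; xs⊆ys++xs)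
open import Relation.Nullary using (contradiction)
open import Relation.Nullary.Reflects using (Reflects; ofʸ; ofⁿ; fromEquivalence)
open import Relation.Binary.PropositionalEquality using (_≡_; _≢_; refl; sym; trans; subst; setoid)
open import Relation.Binary.Definitions using (tri<; tri≈; tri>)

elem-reflects : ∀ k l → Reflects (k ∈ l) (elem k l)
elem-reflects k l = fromEquivalence
  (λ t → Any.map (≡ᵇ⇒≡ k _) (any⁻ (k ≡ᵇ_) l t))
  (λ k∈l → any⁺ (k ≡ᵇ_) (Any.map (≡⇒≡ᵇ k _) k∈l))

mexSearch-minimal : ∀ f k l {j} → k ≤ j → j < mexSearch f k l → j ∈ l
mexSearch-minimal zero k l k≤j j<k = contradiction k≤j (<⇒≱ j<k)
mexSearch-minimal (suc f) k l k≤j j<m with elem k l | elem-reflects k l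
... | false | _ = contradiction k≤j (<⇒≱ j<m)
... | true  | ofʸ k∈l with m≤n⇒m<n∨m≡n k≤j
...   | inj₁ k<j  = mexSearch-minimal f (suc k) l k<j j<m
...   | inj₂ refl = k∈l

mexSearch-∉⊎exhausted : ∀ f k l → mexSearch f k l ∉ l ⊎ mexSearch f k l ≡ f + k
mexSearch-∉⊎exhausted zero k l = inj₂ refl
mexSearch-∉⊎exhausted (suc f) k l with elem k l | elem-reflects k l
... | false | ofⁿ k∉l = inj₁ k∉l
... | true  | _       = Sum.map₂ (λ e → trans e (+-suc f k)) (mexSearch-∉⊎exhausted f (suc k) l)

upTo-suc-length⊈ : ∀ l → upTo (suc (length l)) ⊈ l
upTo-suc-length⊈ l ⊆l =
  let i , j , i<j , same = pigeonhole (n<1+n (length l)) (λ i → index (position i))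
  in <-irrefl (index-injective (setoid ℕ) (position i) (position j) same) i<j
  where
  position : ∀ i → toℕ i ∈ l
  position i = ⊆l (∈-upTo⁺ (toℕ<n i))

Mex-minimal : ∀ l {j} → j < Mex l → j ∈ l
Mex-minimal l = mexSearch-minimal (suc (length l)) 0 l z≤n

-- The search runs out of fuel only if 0, …, length l all lie in l, which the pigeonhole forbids.
Mex-∉ : ∀ l → Mex l ∉ l
Mex-∉ l with mexSearch-∉⊎exhausted (suc (length l)) 0 l
... | inj₁ Mex∉l = Mex∉l
... | inj₂ exhausted =
  contradiction (λ {j} j∈ → Mex-minimal l (subst (_ <_) (sym Mex≡) (∈-upTo⁻ j∈))) (upTo-suc-length⊈ l)
  where
  Mex≡ : Mex l ≡ suc (length l)
  Mex≡ = trans exhausted (+-identityʳ _)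

Mex-> : ∀ l {a} → (∀ {j} → j ≤ a → j ∈ l) → a < Mex l
Mex-> l ≤a⇒∈l = ≰⇒> (λ Mex≤a → Mex-∉ l (≤a⇒∈l Mex≤a))

coords⊆excluded : ∀ a L → coords L ⊆ excluded a L
coords⊆excluded a L = ⊆-trans (xs⊆ys++xs (coords L) (oneTo a)) (xs⊆ys++xs _ (map (a +_) (diffs L)))

oneTo⊆excluded : ∀ a L → oneTo a ⊆ excluded a L
oneTo⊆excluded a L = ⊆-trans (xs⊆xs++ys (oneTo a) (coords L)) (xs⊆ys++xs _ (map (a +_) (diffs L)))

≤⇒∈excluded : ∀ a L → 0 ∈ coords L → ∀ {j} → j ≤ a → j ∈ excluded a L
≤⇒∈excluded a L 0∈L {zero}  _   = coords⊆excluded a L 0∈L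
≤⇒∈excluded a L 0∈L {suc j} j<a = oneTo⊆excluded a L (∈-map⁺ suc (∈-upTo⁺ j<a))

Mex-excluded-∉ : ∀ a L → Mex (excluded a L) ∉ coords L
Mex-excluded-∉ a L ∈L = Mex-∉ (excluded a L) (coords⊆excluded a L ∈L)

<Mex-excluded : ∀ a L → 0 ∈ coords L → a < Mex (excluded a L)
<Mex-excluded a L 0∈L = Mex-> (excluded a L) (≤⇒∈excluded a L 0∈L)

F : ℕ → List ℕ
F n = coords (G n)

newCoords : ℕ → List ℕ
newCoords n = v₁ (suc n) ∷ v₂ (suc n) ∷ v₃ (suc n) ∷ []

F-suc : ∀ n → F (suc n) ≡ F n ++ newCoords n
F-suc n = concatMap-++ _ (G n) (step (G n) ∷ [])

F⊆F-suc : ∀ n → F n ⊆ F (suc n)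
F⊆F-suc n rewrite F-suc n = xs⊆xs++ys (F n) (newCoords n)

newCoords⊆F-suc : ∀ n → newCoords n ⊆ F (suc n)
newCoords⊆F-suc n rewrite F-suc n = xs⊆ys++xs (newCoords n) (F n)

F-mono : ∀ {m n} → m ≤ n → F m ⊆ F n
F-mono {n = zero}  z≤n = ⊆-refl
F-mono {m} {suc n} m≤1+n with m≤n⇒m<n∨m≡n m≤1+n
... | inj₁ m<1+n = ⊆-trans (F-mono (m<1+n⇒m≤n m<1+n)) (F⊆F-suc n)
... | inj₂ refl  = ⊆-refl

0∈F : ∀ n → 0 ∈ F n
0∈F zero    = here refl
0∈F (suc n) = F⊆F-suc n (0∈F n)

newCoords-fresh : ∀ n {x} → x ∈ newCoords n → x ∉ F n
newCoords-fresh n (here refl)                 = Mex-∉ (F n)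
newCoords-fresh n (there (here refl))         = Mex-excluded-∉ (v₁ (suc n)) (G n)
newCoords-fresh n (there (there (here refl))) = Mex-excluded-∉ (v₂ (suc n)) (G n)

0<v₁ : ∀ n → 0 < v₁ (suc n)
0<v₁ n = Mex-> (F n) (λ { z≤n → 0∈F n })

v₁<v₂ : ∀ n → v₁ (suc n) < v₂ (suc n)
v₁<v₂ n = <Mex-excluded (v₁ (suc n)) (G n) (0∈F n)

v₂<v₃ : ∀ n → v₂ (suc n) < v₃ (suc n)
v₂<v₃ n = <Mex-excluded (v₂ (suc n)) (G n) (0∈F n)

∈newCoords-unique : ∀ {x} m n → x ∈ newCoords m → x ∈ newCoords n → m ≡ n
∈newCoords-unique m n x∈m x∈n with <-cmp m n
... | tri< m<n _ _ = contradiction (F-mono m<n (newCoords⊆F-suc m x∈m)) (newCoords-fresh n x∈n)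
... | tri≈ _ m≡n _ = m≡n
... | tri> _ _ n<m = contradiction (F-mono n<m (newCoords⊆F-suc n x∈n)) (newCoords-fresh m x∈m)

≤v₁⇒∈F-suc : ∀ n {j} → j ≤ v₁ (suc n) → j ∈ F (suc n)
≤v₁⇒∈F-suc n j≤v₁ with m≤n⇒m<n∨m≡n j≤v₁
... | inj₁ j<v₁ = F⊆F-suc n (Mex-minimal (F n) j<v₁)
... | inj₂ refl = newCoords⊆F-suc n (here refl)

≤⇒∈F : ∀ n {j} → j ≤ n → j ∈ F n
≤⇒∈F zero    z≤n   = here refl
≤⇒∈F (suc n) j≤1+n = ≤v₁⇒∈F-suc n (≤-trans j≤1+n (Mex-> (F n) (≤⇒∈F n)))

∈F⇒≡0⊎∈newCoords : ∀ n {x} → x ∈ F n → x ≡ 0 ⊎ ∃[ m ] x ∈ newCoords m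
∈F⇒≡0⊎∈newCoords zero (here x≡0)                 = inj₁ x≡0
∈F⇒≡0⊎∈newCoords zero (there (here x≡0))         = inj₁ x≡0
∈F⇒≡0⊎∈newCoords zero (there (there (here x≡0))) = inj₁ x≡0
∈F⇒≡0⊎∈newCoords (suc n) x∈F rewrite F-suc n with ∈-++⁻ (F n) x∈F
... | inj₁ x∈F   = ∈F⇒≡0⊎∈newCoords n x∈F
... | inj₂ x∈new = inj₂ (n , x∈new)

corollary2 :
    (∀ m n → v₁ (suc m) ≢ v₂ (suc n))
    × (∀ m n → v₁ (suc m) ≢ v₃ (suc n))
    × (∀ m n → v₂ (suc m) ≢ v₃ (suc n))
    × (∀ n → 1 ≤ v₁ (suc n) × 1 ≤ v₂ (suc n) × 1 ≤ v₃ (suc n))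
    × (∀ k → 1 ≤ k → ∃[ n ] (v₁ (suc n) ≡ k ⊎ v₂ (suc n) ≡ k ⊎ v₃ (suc n) ≡ k))
corollary2 = v₁≢v₂ , v₁≢v₃ , v₂≢v₃ , positive , covering
  where
  v₁≢v₂ : ∀ m n → v₁ (suc m) ≢ v₂ (suc n)
  v₁≢v₂ m n e with refl ← ∈newCoords-unique m n (here refl) (there (here e)) = <⇒≢ (v₁<v₂ n) e
  v₁≢v₃ : ∀ m n → v₁ (suc m) ≢ v₃ (suc n)
  v₁≢v₃ m n e with refl ← ∈newCoords-unique m n (here refl) (there (there (here e))) =
    <⇒≢ (<-trans (v₁<v₂ n) (v₂<v₃ n)) e
  v₂≢v₃ : ∀ m n → v₂ (suc m) ≢ v₃ (suc n)
  v₂≢v₃ m n e with refl ← ∈newCoords-unique m n (there (here refl)) (there (there (here e))) =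
    <⇒≢ (v₂<v₃ n) e
  positive : ∀ n → 1 ≤ v₁ (suc n) × 1 ≤ v₂ (suc n) × 1 ≤ v₃ (suc n)
  positive n = 0<v₁ n , <-trans (0<v₁ n) (v₁<v₂ n) , <-trans (0<v₁ n) (<-trans (v₁<v₂ n) (v₂<v₃ n))
  covering : ∀ k → 1 ≤ k → ∃[ n ] (v₁ (suc n) ≡ k ⊎ v₂ (suc n) ≡ k ⊎ v₃ (suc n) ≡ k)
  covering k@(suc _) _ with ∈F⇒≡0⊎∈newCoords k (≤⇒∈F k ≤-refl)
  ... | inj₂ (m , here e)                 = m , inj₁ (sym e)
  ... | inj₂ (m , there (here e))         = m , inj₂ (inj₁ (sym e))
  ... | inj₂ (m , there (there (here e))) = m , inj₂ (inj₂ (sym e))
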